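{- Let $G$ be a graph with an odd number $n\geq 9$ of vertices. Then $\mathrm{mp}(G)=2n-4$ if and only if $G=K_n-e$ for some edge $e\in E(K_n)$.
   Context: All graphs are finite, simple and undirected; $K_n-e$ is the complete graph on $n$ vertices with one edge removed. A perfect matching is a set of edges covering every vertex exactly once; an almost-perfect matching is a set of edges covering every vertex except one exactly once and missing the remaining vertex. The matching preclusion number $\mathrm{mp}(G)$ is the minimum number of edges whose deletion leaves a graph with neither a perfect matching nor an almost-perfect matching ($\mathrm{mp}(G)=0$ if $G$ has neither). -}

module Defs where

open import Data.Nat using (ℕ; zero; suc; _+_; _<_)
open import Data.Bool using (Bool; true; false; _∧_; if_then_else_)
open import Data.Fin using (Fin; toℕ)
open import Data.Fin.Properties using () renaming (_<?_ to _<ᶠ?_)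
open import Data.List using (List; map; allFin)
open import Data.Nat.ListAction using (sum)
open import Data.Product using (Σ; _×_; _,_; ∃)
open import Data.Sum using (_⊎_)
open import Relation.Nullary using (¬_; does)
open import Relation.Binary.PropositionalEquality using (_≡_; _≢_)

record Graph (n : ℕ) : Set where
  field
    adj    : Fin n → Fin n → Bool
    sym    : ∀ i j → adj i j ≡ adj j i
    irrefl : ∀ i → adj i i ≡ false
open Graph public

_⊆ᴳ_ : ∀ {n} → Graph n → Graph n → Set
H ⊆ᴳ G = ∀ i j → adj H i j ≡ true → adj G i j ≡ true

numEdges : ∀ {n} → Graph n → ℕ
numEdges {n} G =
  sum (map (λ i → sum (map (λ j →
    if does (i <ᶠ? j) ∧ adj G i j then 1 else 0) (allFin n))) (allFin n))

CoveredOnce : ∀ {n} → Graph n → Fin n → Set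
CoveredOnce M v = Σ _ λ u → (adj M v u ≡ true) × (∀ w → adj M v w ≡ true → w ≡ u)

Uncovered : ∀ {n} → Graph n → Fin n → Set
Uncovered M v = ∀ w → adj M v w ≡ false

-- M (an edge set, viewed as a spanning subgraph) is a perfect matching of H
IsPerfectMatching : ∀ {n} → Graph n → Graph n → Set
IsPerfectMatching H M = (M ⊆ᴳ H) × (∀ v → CoveredOnce M v)

IsAlmostPerfectMatching : ∀ {n} → Graph n → Graph n → Set
IsAlmostPerfectMatching H M =
  (M ⊆ᴳ H) × (Σ _ λ x → Uncovered M x × (∀ v → v ≢ x → CoveredOnce M v))

HasPM : ∀ {n} → Graph n → Set
HasPM H = Σ _ λ M → IsPerfectMatching H M

HasAPM : ∀ {n} → Graph n → Set
HasAPM H = Σ _ λ M → IsAlmostPerfectMatching H M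

-- Deleting an edge set F ⊆ E(G) from G leaves the spanning subgraph H = G - F, with
-- |F| = numEdges G - numEdges H.  mp(G) = k means k is the minimum size of such an F
-- for which G - F has neither a perfect nor an almost-perfect matching.
IsMP : ∀ {n} → Graph n → ℕ → Set
IsMP G k =
  (Σ _ λ H → (H ⊆ᴳ G) × (numEdges G ≡ numEdges H + k) × ¬ HasPM H × ¬ HasAPM H)
  × (∀ H → H ⊆ᴳ G → numEdges G < numEdges H + k → HasPM H ⊎ HasAPM H)

IsKnMinusEdge : ∀ {n} → Graph n → Set
IsKnMinusEdge {n} G = Σ (Fin n) λ a → Σ (Fin n) λ b → a ≢ b ×
  (∀ i j → adj G i j ≡ true
           → (i ≢ j × ¬ ((i ≡ a × j ≡ b) ⊎ (i ≡ b × j ≡ a)))) ×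
  (∀ i j → i ≢ j → ¬ ((i ≡ a × j ≡ b) ⊎ (i ≡ b × j ≡ a)) → adj G i j ≡ true)

module Submission where

-- The core is a sufficient condition for almost-perfect matchings: a graph
-- on 2m + 1 vertices with at most oddBudget m non-edges has one, and
-- oddBudget m = 2(2m + 1) − 4 once m ≥ 4 (`few-non-edges⇒almost-perfect`).
-- It is proved for all vertex subsets W by a greedy induction that matches
-- a vertex p of maximum non-degree in W with its neighbour q of maximum
-- non-degree and recurses on W − p − q (an isolated p is left out instead).
-- The bookkeeping uses the defect of W, the sum of the non-degrees inside
-- W, which is twice the number of non-edges inside W; short arithmetic
-- lemmas show that the remainder always fits the budget of its size.
--
-- Deleting k edges adds k
-- non-edges; isolating two vertices u, v kills every perfect and
-- almost-perfect matching and adds 2n − 3 non-edges minus those already at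
-- u or v.  For K_n − ab, isolating a and b costs 2n − 4, and fewer
-- deletions leave at most 2n − 4 non-edges.  Conversely, if mp(G) = 2n − 4
-- then G is not complete, and a second non-edge would give two vertices
-- whose isolation is cheaper.

open import Defs hiding (sym)
open import Data.Nat using (ℕ; zero; suc; _+_; _*_; _∸_; _%_; _/_; _≤_; _<_; z≤n; s≤s; _≤?_)
open import Data.Nat.Properties hiding (_≟_)
open import Data.Nat.DivMod using (m≡m%n+[m/n]*n)
open import Data.Nat.ListAction using () renaming (sum to listSum)
open import Data.Nat.Solver using (module +-*-Solver)
open import Data.Bool using (Bool; true; false; _∧_; _∨_; not; if_then_else_)
import Data.Bool.Properties as Bool
open import Data.Fin using (Fin; zero; suc; toℕ; fromℕ<)
open import Data.Fin.Properties using (_≟_; any?; all?; toℕ-fromℕ<)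
  renaming (_<?_ to _<ᶠ?_; <-cmp to <ᶠ-cmp; <-irrefl to <ᶠ-irrefl)
open import Data.List using (map; allFin; tabulate)
open import Data.List.Properties using (map-tabulate)
open import Data.Product using (∃; _×_; _,_; proj₁; proj₂)
open import Data.Sum using (_⊎_; inj₁; inj₂; [_,_])
open import Data.Empty using (⊥; ⊥-elim)
open import Function.Bundles using (_⇔_; mk⇔)
open import Relation.Nullary using (¬_; Dec; yes; no; does; ¬?)
open import Relation.Nullary.Decidable using (dec-true; dec-false; toWitness; _×-dec_)
open import Relation.Binary.Definitions using (tri<; tri≈; tri>)
open import Relation.Binary.PropositionalEquality
  using (_≡_; _≢_; refl; sym; trans; cong; cong₂; subst; subst₂; module ≡-Reasoning)
open import Algebra.Properties.Semiring.Sum +-*-semiring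
  using (sum; sum-syntax; sum-cong-≗; ∑-distrib-+; ∑-comm; *-distribʳ-sum; sum-replicate-zero)
open import Algebra.Properties.CommutativeSemigroup +-commutativeSemigroup using (x∙yz≈y∙xz)
open +-*-Solver using (solve; _:+_; _:*_; con; _:=_)

⟦_⟧ : Bool → ℕ
⟦ b ⟧ = if b then 1 else 0

_≡ᵇ_ : ∀ {n} → Fin n → Fin n → Bool
i ≡ᵇ j = does (i ≟ j)

≡ᵇ-refl : ∀ {n} (i : Fin n) → (i ≡ᵇ i) ≡ true
≡ᵇ-refl i = dec-true (i ≟ i) refl

≡ᵇ-≢ : ∀ {n} {i j : Fin n} → i ≢ j → (i ≡ᵇ j) ≡ false
≡ᵇ-≢ {i = i} {j} i≢j = dec-false (i ≟ j) i≢j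

≡ᵇ-sound : ∀ {n} {i j : Fin n} → (i ≡ᵇ j) ≡ true → i ≡ j
≡ᵇ-sound {i = i} {j} eq with i ≟ j
... | yes i≡j = i≡j

≡ᵇ-sym : ∀ {n} (i j : Fin n) → (i ≡ᵇ j) ≡ (j ≡ᵇ i)
≡ᵇ-sym i j with i ≟ j
... | yes refl = sym (≡ᵇ-refl i)
... | no i≢j = sym (≡ᵇ-≢ (λ j≡i → i≢j (sym j≡i)))

sum-pick : ∀ {n} (p : Fin n) (f : Fin n → ℕ) →
           sum f ≡ f p + ∑[ y < n ] (if y ≡ᵇ p then 0 else f y)
sum-pick {suc n} zero    f = refl
sum-pick {suc n} (suc p) f = begin
  f zero + sum (λ i → f (suc i))                                     ≡⟨ cong (f zero +_) (sum-pick p (λ i → f (suc i))) ⟩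
  f zero + (f (suc p) + ∑[ y < n ] (if y ≡ᵇ p then 0 else f (suc y))) ≡⟨ x∙yz≈y∙xz (f zero) (f (suc p)) _ ⟩
  f (suc p) + (f zero + ∑[ y < n ] (if y ≡ᵇ p then 0 else f (suc y))) ∎
  where open ≡-Reasoning

sum-mono : ∀ {n} {f g : Fin n → ℕ} → (∀ i → f i ≤ g i) → sum f ≤ sum g
sum-mono {zero}  f≤g = z≤n
sum-mono {suc n} f≤g = +-mono-≤ (f≤g zero) (sum-mono (λ i → f≤g (suc i)))

term≤sum : ∀ {n} (f : Fin n → ℕ) p → f p ≤ sum f
term≤sum f p = subst (f p ≤_) (sym (sum-pick p f)) (m≤m+n (f p) _)

sum≡0⇒term≡0 : ∀ {n} (f : Fin n → ℕ) → sum f ≡ 0 → ∀ i → f i ≡ 0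
sum≡0⇒term≡0 {suc n} f sum≡0 zero    = m+n≡0⇒m≡0 (f zero) sum≡0
sum≡0⇒term≡0 {suc n} f sum≡0 (suc i) = sum≡0⇒term≡0 (λ i → f (suc i)) (m+n≡0⇒n≡0 (f zero) sum≡0) i

sum-pos⇒term-pos : ∀ {n} (f : Fin n → ℕ) → 0 < sum f → ∃ λ i → 0 < f i
sum-pos⇒term-pos {suc n} f pos with f zero in eq
... | suc _ = zero , subst (0 <_) (sym eq) (s≤s z≤n)
... | zero  with sum-pos⇒term-pos (λ i → f (suc i)) pos
...   | i , fi>0 = suc i , fi>0

sum≥2 : ∀ {n} (f : Fin n → ℕ) {a b : Fin n} → a ≢ b → 1 ≤ f a → 1 ≤ f b → 2 ≤ sum f
sum≥2 f {a} {b} a≢b fa≥1 fb≥1 =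
  subst (2 ≤_) (sym (sum-pick a f)) (+-mono-≤ fa≥1 (≤-trans fb≥1′ (term≤sum _ b)))
  where
  fb≥1′ : 1 ≤ (if b ≡ᵇ a then 0 else f b)
  fb≥1′ rewrite ≡ᵇ-≢ (λ b≡a → a≢b (sym b≡a)) = fb≥1

count : ∀ {n} → (Fin n → Bool) → ℕ
count P = ∑[ y < _ ] ⟦ P y ⟧

count-full : ∀ n → count {n} (λ _ → true) ≡ n
count-full zero    = refl
count-full (suc n) = cong suc (count-full n)

count-point : ∀ {n} (p : Fin n) → count (_≡ᵇ p) ≡ 1
count-point {n} p = begin
  count (_≡ᵇ p)                                          ≡⟨ sum-pick p _ ⟩
  ⟦ p ≡ᵇ p ⟧ + ∑[ y < n ] (if y ≡ᵇ p then 0 else ⟦ y ≡ᵇ p ⟧) ≡⟨ cong₂ _+_ (cong ⟦_⟧ (≡ᵇ-refl p)) (sum-cong-≗ off-p) ⟩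
  1 + ∑[ y < n ] 0                                         ≡⟨ cong suc (sum-replicate-zero n) ⟩
  1                                                        ∎
  where
  open ≡-Reasoning
  off-p : ∀ y → (if y ≡ᵇ p then 0 else ⟦ y ≡ᵇ p ⟧) ≡ 0
  off-p y with y ≡ᵇ p
  ... | true  = refl
  ... | false = refl

count-pos⇒witness : ∀ {n} (P : Fin n → Bool) → 0 < count P → ∃ λ y → P y ≡ true
count-pos⇒witness P pos with sum-pos⇒term-pos _ pos
... | y , ⟦Py⟧>0 with P y in Py
...   | true = y , Py
count-pos⇒witness P pos | y , () | false

argmax : ∀ {n} (P : Fin n → Bool) (f : Fin n → ℕ) → ∃ (λ x → P x ≡ true) →
         ∃ λ x → P x ≡ true × (∀ y → P y ≡ true → f y ≤ f x)
argmax {suc n} P f (x , Px) with any? (λ i → P (suc i) Bool.≟ true)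
... | no no-tail = zero , P0 x Px , λ { zero _ → ≤-refl ; (suc y) Py → ⊥-elim (no-tail (y , Py)) }
  where
  P0 : ∀ x → P x ≡ true → P zero ≡ true
  P0 zero    Px = Px
  P0 (suc y) Py = ⊥-elim (no-tail (y , Py))
... | yes tail-ne with argmax (λ i → P (suc i)) (λ i → f (suc i)) tail-ne
...   | x′ , Px′ , max′ with P zero in P0 | f zero ≤? f (suc x′)
...     | false | _      = suc x′ , Px′ , λ { zero P0′   → ⊥-elim (false≢true (trans (sym P0) P0′))
                                             ; (suc y) Py → max′ y Py }
  where
  false≢true : false ≢ true
  false≢true ()
...     | true  | yes f0≤ = suc x′ , Px′ , λ { zero _ → f0≤ ; (suc y) Py → max′ y Py }
...     | true  | no f0≰  = zero , P0 , λ { zero _ → ≤-refl ; (suc y) Py → ≤-trans (max′ y Py) (<⇒≤ (≰⇒> f0≰)) }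

Subset : ℕ → Set
Subset n = Fin n → Bool

full : ∀ {n} → Subset n
full _ = true

_─_ : ∀ {n} → Subset n → Fin n → Subset n
(W ─ p) y = W y ∧ not (y ≡ᵇ p)

─-outside : ∀ {n} (W : Subset n) p v → W v ≡ false → (W ─ p) v ≡ false
─-outside W p v Wv rewrite Wv = refl

─-inside : ∀ {n} (W : Subset n) p v → W v ≡ true → v ≢ p → (W ─ p) v ≡ true
─-inside W p v Wv v≢p rewrite Wv | ≡ᵇ-≢ v≢p = refl

─-removed : ∀ {n} (W : Subset n) p → (W ─ p) p ≡ false
─-removed W p rewrite ≡ᵇ-refl p = Bool.∧-zeroʳ (W p)

─-⊆ : ∀ {n} (W : Subset n) p v → (W ─ p) v ≡ true → W v ≡ true
─-⊆ W p v W─pv with W v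
... | true = refl

size-remove : ∀ {n} (W : Subset n) p → W p ≡ true → count W ≡ suc (count (W ─ p))
size-remove W p Wp = trans (sum-pick p _) (cong₂ _+_ (cong ⟦_⟧ Wp) (sum-cong-≗ off-p))
  where
  off-p : ∀ y → (if y ≡ᵇ p then 0 else ⟦ W y ⟧) ≡ ⟦ (W ─ p) y ⟧
  off-p y with W y | y ≡ᵇ p
  ... | true  | true  = refl
  ... | true  | false = refl
  ... | false | true  = refl
  ... | false | false = refl

-- The
-- defect of W is the sum of the non-degrees inside W, i.e. twice the number
-- of non-edges of H inside W; the greedy matching construction is driven
-- by how it changes when vertices are removed.
module NonDegree {n : ℕ} (H : Graph n) where

  NonNbr Nbr : Subset n → Fin n → Subset n
  NonNbr W x y = W y ∧ not (y ≡ᵇ x) ∧ not (adj H x y)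
  Nbr    W x y = W y ∧ not (y ≡ᵇ x) ∧ adj H x y

  nonDeg deg : Subset n → Fin n → ℕ
  nonDeg W x = count (NonNbr W x)
  deg    W x = count (Nbr W x)

  defect : Subset n → ℕ
  defect W = ∑[ x < n ] (if W x then nonDeg W x else 0)

  Nbr-sound : ∀ W x y → Nbr W x y ≡ true → W y ≡ true × y ≢ x × adj H x y ≡ true
  Nbr-sound W x y nbr with W y | y ≡ᵇ x in y≟x | adj H x y
  ... | true | false | true = refl , y≢x , refl
    where
    y≢x : y ≢ x
    y≢x refl with trans (sym y≟x) (≡ᵇ-refl y)
    ... | ()

  NonNbr-intro : ∀ W x y → W y ≡ true → y ≢ x → adj H x y ≡ false → NonNbr W x y ≡ true
  NonNbr-intro W x y Wy y≢x non-adj rewrite Wy | ≡ᵇ-≢ y≢x | non-adj = refl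

  nonNbr⇒nonDeg≥1 : ∀ W x y → NonNbr W x y ≡ true → 1 ≤ nonDeg W x
  nonNbr⇒nonDeg≥1 W x y nonNbr = ≤-trans (≤-reflexive (cong ⟦_⟧ (sym nonNbr))) (term≤sum _ y)

  -- The number of non-edges of H meeting u or v.
  nonEdgesAt : Fin n → Fin n → ℕ
  nonEdgesAt u v = nonDeg full u + nonDeg (full ─ u) v

  nonDeg-remove : ∀ W p x → nonDeg W x ≡ nonDeg (W ─ p) x + ⟦ NonNbr W x p ⟧
  nonDeg-remove W p x =
    trans (sum-pick p _) (trans (+-comm ⟦ NonNbr W x p ⟧ _) (cong (_+ ⟦ NonNbr W x p ⟧) (sum-cong-≗ off-p)))
    where
    off-p : ∀ y → (if y ≡ᵇ p then 0 else ⟦ NonNbr W x y ⟧) ≡ ⟦ NonNbr (W ─ p) x y ⟧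
    off-p y with W y | y ≡ᵇ p
    ... | true  | true  = refl
    ... | true  | false = refl
    ... | false | true  = refl
    ... | false | false = refl

  nonDeg-remove-nbr : ∀ W p q → adj H p q ≡ true → nonDeg (W ─ p) q ≡ nonDeg W q
  nonDeg-remove-nbr W p q adj-pq =
    sym (trans (nonDeg-remove W p q) (trans (cong (nonDeg (W ─ p) q +_) p-adjacent) (+-identityʳ _)))
    where
    p-adjacent : ⟦ NonNbr W q p ⟧ ≡ 0
    p-adjacent rewrite Graph.sym H q p | adj-pq = cong ⟦_⟧ (trans (cong (W p ∧_) (Bool.∧-zeroʳ _)) (Bool.∧-zeroʳ _))

  -- Removing p from W removes its non-edges, each counted twice.
  defect-remove : ∀ W p → W p ≡ true → defect W ≡ defect (W ─ p) + 2 * nonDeg W p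
  defect-remove W p Wp = begin
    defect W
      ≡⟨ sum-pick p _ ⟩
    (if W p then k else 0) + ∑[ x < n ] (if x ≡ᵇ p then 0 else if W x then nonDeg W x else 0)
      ≡⟨ cong₂ _+_ (cong (λ b → if b then k else 0) Wp) (sum-cong-≗ split) ⟩
    k + ∑[ x < n ] (inside-rest x + ⟦ NonNbr W p x ⟧)
      ≡⟨ cong (k +_) (∑-distrib-+ inside-rest (λ x → ⟦ NonNbr W p x ⟧)) ⟩
    k + (defect (W ─ p) + k)
      ≡⟨ +-comm k _ ⟩
    defect (W ─ p) + k + k
      ≡⟨ +-assoc (defect (W ─ p)) k k ⟩
    defect (W ─ p) + (k + k)
      ≡⟨ cong (λ z → defect (W ─ p) + (k + z)) (sym (+-identityʳ k)) ⟩
    defect (W ─ p) + 2 * k ∎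
    where
    open ≡-Reasoning
    k : ℕ
    k = nonDeg W p
    inside-rest : Fin n → ℕ
    inside-rest x = if (W ─ p) x then nonDeg (W ─ p) x else 0
    -- For x ≠ p in W, the term of x loses ⟦ p non-adjacent to x ⟧, which is
    -- exactly the term of x in the count of non-neighbours of p.
    split : ∀ x → (if x ≡ᵇ p then 0 else if W x then nonDeg W x else 0)
                ≡ (if (W ─ p) x then nonDeg (W ─ p) x else 0) + ⟦ NonNbr W p x ⟧
    split x rewrite nonDeg-remove W p x | Wp | ≡ᵇ-sym x p | Graph.sym H x p with W x | p ≡ᵇ x
    ... | true  | true  = refl
    ... | true  | false = refl
    ... | false | true  = refl
    ... | false | false = refl

  defect≥ : ∀ W p → W p ≡ true → 2 * nonDeg W p ≤ defect W
  defect≥ W p Wp = subst (2 * nonDeg W p ≤_) (sym (defect-remove W p Wp)) (m≤n+m (2 * nonDeg W p) (defect (W ─ p)))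

  deg+nonDeg : ∀ W x → W x ≡ true → deg W x + nonDeg W x + 1 ≡ count W
  deg+nonDeg W x Wx =
    trans (cong (_+ 1) (trans (sym (∑-distrib-+ (λ y → ⟦ Nbr W x y ⟧) (λ y → ⟦ NonNbr W x y ⟧))) (sum-cong-≗ split)))
          (trans (+-comm _ 1) (sym (size-remove W x Wx)))
    where
    split : ∀ y → ⟦ Nbr W x y ⟧ + ⟦ NonNbr W x y ⟧ ≡ ⟦ (W ─ x) y ⟧
    split y with W y | y ≡ᵇ x | adj H x y
    ... | true  | true  | _     = refl
    ... | true  | false | true  = refl
    ... | true  | false | false = refl
    ... | false | _     | _     = refl

  -- If p has the largest non-degree k in W and its neighbours have
  -- non-degree at most e, then the k non-neighbours of p contribute at
  -- most k each and its deg neighbours at most e each.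
  defect-bound : ∀ W p e → W p ≡ true →
                 (∀ y → W y ≡ true → nonDeg W y ≤ nonDeg W p) →
                 (∀ y → Nbr W p y ≡ true → nonDeg W y ≤ e) →
                 defect W ≤ nonDeg W p + (nonDeg W p * nonDeg W p + deg W p * e)
  defect-bound W p e Wp p-max nbr≤e =
    subst (_≤ k + (k * k + deg W p * e)) (sym (sum-pick p _))
          (+-mono-≤ (≤-reflexive (cong (λ b → if b then k else 0) Wp)) (≤-trans (sum-mono term≤) (≤-reflexive total)))
    where
    k : ℕ
    k = nonDeg W p
    bound : Fin n → ℕ
    bound x = ⟦ NonNbr W p x ⟧ * k + ⟦ Nbr W p x ⟧ * e
    term≤ : ∀ x → (if x ≡ᵇ p then 0 else if W x then nonDeg W x else 0) ≤ bound x
    term≤ x with W x in Wx | x ≡ᵇ p in x≟p | adj H p x in adj-px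
    ... | true  | true  | _     = z≤n
    ... | false | true  | _     = z≤n
    ... | false | false | _     = z≤n
    ... | true  | false | false = ≤-trans (p-max x Wx) (≤-reflexive (sym (trans (+-identityʳ (1 * k)) (*-identityˡ k))))
    ... | true  | false | true  = ≤-trans (nbr≤e x nbr) (≤-reflexive (sym (*-identityˡ e)))
      where
      nbr : Nbr W p x ≡ true
      nbr rewrite Wx | x≟p | adj-px = refl
    total : sum bound ≡ k * k + deg W p * e
    total = trans (∑-distrib-+ (λ x → ⟦ NonNbr W p x ⟧ * k) (λ x → ⟦ Nbr W p x ⟧ * e))
                  (cong₂ _+_ (sym (*-distribʳ-sum k (λ x → ⟦ NonNbr W p x ⟧)))
                             (sym (*-distribʳ-sum e (λ x → ⟦ Nbr W p x ⟧))))

isPair : ∀ {n} → Fin n → Fin n → Fin n → Fin n → Bool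
isPair p q i j = (i ≡ᵇ p ∧ j ≡ᵇ q) ∨ (i ≡ᵇ q ∧ j ≡ᵇ p)

isPair-sym : ∀ {n} (p q i j : Fin n) → isPair p q i j ≡ isPair p q j i
isPair-sym p q i j =
  trans (Bool.∨-comm (i ≡ᵇ p ∧ j ≡ᵇ q) (i ≡ᵇ q ∧ j ≡ᵇ p))
        (cong₂ _∨_ (Bool.∧-comm (i ≡ᵇ q) (j ≡ᵇ p)) (Bool.∧-comm (i ≡ᵇ p) (j ≡ᵇ q)))

isPair-irrefl : ∀ {n} {p q : Fin n} → p ≢ q → ∀ i → isPair p q i i ≡ false
isPair-irrefl {p = p} {q} p≢q i with i ≡ᵇ p in i≟p | i ≡ᵇ q in i≟q
... | true  | true  = ⊥-elim (p≢q (trans (sym (≡ᵇ-sound {i = i} i≟p)) (≡ᵇ-sound {i = i} i≟q)))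
... | true  | false = refl
... | false | true  = refl
... | false | false = refl

isPair-sound : ∀ {n} (p q i j : Fin n) → isPair p q i j ≡ true → (i ≡ p × j ≡ q) ⊎ (i ≡ q × j ≡ p)
isPair-sound p q i j pair with i ≡ᵇ p in i≟p | j ≡ᵇ q in j≟q | i ≡ᵇ q in i≟q | j ≡ᵇ p in j≟p
... | true  | true  | _    | _    = inj₁ (≡ᵇ-sound i≟p , ≡ᵇ-sound j≟q)
... | true  | false | true | true = inj₂ (≡ᵇ-sound i≟q , ≡ᵇ-sound j≟p)
... | false | _     | true | true = inj₂ (≡ᵇ-sound i≟q , ≡ᵇ-sound j≟p)

isPair-complete : ∀ {n} (p q i j : Fin n) → (i ≡ p × j ≡ q) ⊎ (i ≡ q × j ≡ p) → isPair p q i j ≡ true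
isPair-complete p q .p .q (inj₁ (refl , refl)) rewrite ≡ᵇ-refl p | ≡ᵇ-refl q = refl
isPair-complete p q .q .p (inj₂ (refl , refl)) rewrite ≡ᵇ-refl p | ≡ᵇ-refl q = Bool.∨-zeroʳ _

-- Only a and b have a partner in the pair {a, b}.
count-isPair : ∀ {n} {a b : Fin n} → a ≢ b → ∀ x → count (isPair a b x) ≡ ⟦ x ≡ᵇ a ⟧ + ⟦ x ≡ᵇ b ⟧
count-isPair {n} {a} {b} a≢b x with x ≟ a | x ≟ b
... | yes refl | yes refl = ⊥-elim (a≢b refl)
... | yes _    | no _     = trans (sum-cong-≗ (λ y → cong ⟦_⟧ (Bool.∨-identityʳ (y ≡ᵇ b)))) (count-point b)
... | no _     | yes _    = count-point a
... | no _     | no _     = sum-replicate-zero n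

addEdge : ∀ {n} → Graph n → (p q : Fin n) → p ≢ q → Graph n
addEdge M p q p≢q = record
  { adj    = λ i j → isPair p q i j ∨ adj M i j
  ; sym    = λ i j → cong₂ _∨_ (isPair-sym p q i j) (Graph.sym M i j)
  ; irrefl = λ i → cong₂ _∨_ (isPair-irrefl p≢q i) (Graph.irrefl M i)
  }

module _ {n : ℕ} (M : Graph n) (p q : Fin n) (p≢q : p ≢ q) where

  addEdge-at-p : ∀ w → adj (addEdge M p q p≢q) p w ≡ (w ≡ᵇ q) ∨ adj M p w
  addEdge-at-p w rewrite ≡ᵇ-refl p | ≡ᵇ-≢ p≢q = cong (_∨ adj M p w) (Bool.∨-identityʳ (w ≡ᵇ q))

  addEdge-at-q : ∀ w → adj (addEdge M p q p≢q) q w ≡ (w ≡ᵇ p) ∨ adj M q w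
  addEdge-at-q w rewrite ≡ᵇ-refl q | ≡ᵇ-≢ (λ q≡p → p≢q (sym q≡p)) = refl

  addEdge-elsewhere : ∀ i w → i ≢ p → i ≢ q → adj (addEdge M p q p≢q) i w ≡ adj M i w
  addEdge-elsewhere i w i≢p i≢q rewrite ≡ᵇ-≢ i≢p | ≡ᵇ-≢ i≢q = refl

-- The greedy construction builds
-- these for shrinking subsets and extends them by one edge at a time.
module MatchingOn {n : ℕ} (H : Graph n) where

  record PerfectOn (W : Subset n) : Set where
    field
      M       : Graph n
      M⊆H     : M ⊆ᴳ H
      outside : ∀ v → W v ≡ false → Uncovered M v
      covers  : ∀ v → W v ≡ true → CoveredOnce M v

  record AlmostPerfectOn (W : Subset n) : Set where
    field
      M        : Graph n
      M⊆H      : M ⊆ᴳ H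
      outside  : ∀ v → W v ≡ false → Uncovered M v
      missed   : Fin n
      missed∈W : W missed ≡ true
      uncovers : Uncovered M missed
      covers   : ∀ v → W v ≡ true → v ≢ missed → CoveredOnce M v

  perfectOn-empty : ∀ W → count W ≡ 0 → PerfectOn W
  perfectOn-empty W |W|≡0 = record
    { M = empty ; M⊆H = λ _ _ () ; outside = λ _ _ _ → refl ; covers = nothing-to-cover }
    where
    empty : Graph n
    empty = record { adj = λ _ _ → false ; sym = λ _ _ → refl ; irrefl = λ _ → refl }
    nothing-to-cover : ∀ v → W v ≡ true → CoveredOnce empty v
    nothing-to-cover v Wv with sum≡0⇒term≡0 _ |W|≡0 v
    ... | ⟦Wv⟧≡0 rewrite Wv with ⟦Wv⟧≡0
    ...   | ()

  leave-out : ∀ W p → W p ≡ true → PerfectOn (W ─ p) → AlmostPerfectOn W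
  leave-out W p Wp P = record
    { M = M ; M⊆H = M⊆H ; outside = λ v Wv → outside v (─-outside W p v Wv)
    ; missed = p ; missed∈W = Wp ; uncovers = outside p (─-removed W p)
    ; covers = λ v Wv v≢p → covers v (─-inside W p v Wv v≢p) }
    where open PerfectOn P

  module AddMatchedEdge (W : Subset n) (p q : Fin n) (Wp : W p ≡ true) (Wq : W q ≡ true)
                        (p≢q : p ≢ q) (adj-pq : adj H p q ≡ true)
                        (M : Graph n) (M⊆H : M ⊆ᴳ H)
                        (outside : ∀ v → ((W ─ p) ─ q) v ≡ false → Uncovered M v) where

    M′ : Graph n
    M′ = addEdge M p q p≢q

    M′⊆H : M′ ⊆ᴳ H
    M′⊆H i j M′ij with isPair p q i j in pair
    ... | false = M⊆H i j M′ij
    ... | true  with isPair-sound p q i j pair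
    ...   | inj₁ (refl , refl) = adj-pq
    ...   | inj₂ (refl , refl) = trans (Graph.sym H q p) adj-pq

    p-out : ((W ─ p) ─ q) p ≡ false
    p-out = ─-outside (W ─ p) q p (─-removed W p)

    q-out : ((W ─ p) ─ q) q ≡ false
    q-out = ─-removed (W ─ p) q

    outside′ : ∀ v → W v ≡ false → Uncovered M′ v
    outside′ v Wv w = trans (addEdge-elsewhere M p q p≢q v w v≢p v≢q)
                            (outside v (─-outside (W ─ p) q v (─-outside W p v Wv)) w)
      where
      v≢p : v ≢ p
      v≢p refl with trans (sym Wp) Wv
      ... | ()
      v≢q : v ≢ q
      v≢q refl with trans (sym Wq) Wv
      ... | ()

    covers-p : CoveredOnce M′ p
    covers-p = q , trans (addEdge-at-p M p q p≢q q) (cong (_∨ adj M p q) (≡ᵇ-refl q)) , only-q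
      where
      only-q : ∀ w → adj M′ p w ≡ true → w ≡ q
      only-q w M′pw = ≡ᵇ-sound (trans (sym (Bool.∨-identityʳ _))
                        (trans (cong ((w ≡ᵇ q) ∨_) (sym (outside p p-out w))) (trans (sym (addEdge-at-p M p q p≢q w)) M′pw)))

    covers-q : CoveredOnce M′ q
    covers-q = p , trans (addEdge-at-q M p q p≢q p) (cong (_∨ adj M q p) (≡ᵇ-refl p)) , only-p
      where
      only-p : ∀ w → adj M′ q w ≡ true → w ≡ p
      only-p w M′qw = ≡ᵇ-sound (trans (sym (Bool.∨-identityʳ _))
                        (trans (cong ((w ≡ᵇ p) ∨_) (sym (outside q q-out w))) (trans (sym (addEdge-at-q M p q p≢q w)) M′qw)))

    covers-other : ∀ v → v ≢ p → v ≢ q → CoveredOnce M v → CoveredOnce M′ v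
    covers-other v v≢p v≢q (u , Mvu , only-u) =
      u , trans (addEdge-elsewhere M p q p≢q v u v≢p v≢q) Mvu
        , λ w M′vw → only-u w (trans (sym (addEdge-elsewhere M p q p≢q v w v≢p v≢q)) M′vw)

    covers-W : ∀ v → W v ≡ true → (((W ─ p) ─ q) v ≡ true → CoveredOnce M v) → CoveredOnce M′ v
    covers-W v Wv old = by-cases (v ≟ p) (v ≟ q)
      where
      by-cases : Dec (v ≡ p) → Dec (v ≡ q) → CoveredOnce M′ v
      by-cases (yes refl) _          = covers-p
      by-cases (no _)     (yes refl) = covers-q
      by-cases (no v≢p)   (no v≢q)   = covers-other v v≢p v≢q (old (─-inside (W ─ p) q v (─-inside W p v Wv v≢p) v≢q))

  extend-perfect : ∀ W p q → W p ≡ true → W q ≡ true → p ≢ q → adj H p q ≡ true →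
                   PerfectOn ((W ─ p) ─ q) → PerfectOn W
  extend-perfect W p q Wp Wq p≢q adj-pq P = record
    { M = M′ ; M⊆H = M′⊆H ; outside = outside′ ; covers = λ v Wv → covers-W v Wv (covers v) }
    where
    open PerfectOn P
    open AddMatchedEdge W p q Wp Wq p≢q adj-pq M M⊆H outside

  extend-almost : ∀ W p q → W p ≡ true → W q ≡ true → p ≢ q → adj H p q ≡ true →
                  AlmostPerfectOn ((W ─ p) ─ q) → AlmostPerfectOn W
  extend-almost W p q Wp Wq p≢q adj-pq A = record
    { M = M′ ; M⊆H = M′⊆H ; outside = outside′
    ; missed = missed ; missed∈W = ─-⊆ W p missed (─-⊆ (W ─ p) q missed missed∈W)
    ; uncovers = λ w → trans (addEdge-elsewhere M p q p≢q missed w missed≢p missed≢q) (uncovers w)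
    ; covers = λ v Wv v≢missed → covers-W v Wv (λ inside → covers v inside v≢missed) }
    where
    open AlmostPerfectOn A
    open AddMatchedEdge W p q Wp Wq p≢q adj-pq M M⊆H outside
    missed≢p : missed ≢ p
    missed≢p refl with trans (sym missed∈W) p-out
    ... | ()
    missed≢q : missed ≢ q
    missed≢q refl with trans (sym missed∈W) q-out
    ... | ()

-- Non-edge budgets of the greedy construction: a set of 2h vertices
-- spanning at most evenBudget h non-edges has a perfect matching, and a set
-- of 2m + 1 vertices spanning at most oddBudget m non-edges has an
-- almost-perfect one.  From m = 4 on, oddBudget m = 4m − 2 = 2(2m + 1) − 4.
-- The lemmas below are the arithmetic of one greedy step in terms of the
-- remaining defect D, the non-degrees k of p and e of q, and the degree d
-- of p; each either shows that the rest fits its budget or rules the step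
-- out.
evenBudget : ℕ → ℕ
evenBudget zero    = 0
evenBudget (suc h) = h + h

oddBudget : ℕ → ℕ
oddBudget 0 = 0
oddBudget 1 = 2
oddBudget 2 = 5
oddBudget 3 = 9
oddBudget (suc (suc (suc (suc j)))) = 14 + 4 * j

-- If D exceeds 2B while D + c fits into 2B′ ≤ 2(B + s), then c < 2s:
-- the increment of a budget bounds what one greedy step may cost.
increment-bound : ∀ B B′ s D c → 2 * B < D → D + c ≤ 2 * B′ → B′ ≤ B + s → c < 2 * s
increment-bound B B′ s D c 2B<D fits B′≤B+s = +-cancelˡ-≤ (2 * B) (suc c) (2 * s) (begin
  2 * B + suc c  ≡⟨ +-suc (2 * B) c ⟩
  suc (2 * B) + c ≤⟨ +-monoˡ-≤ c 2B<D ⟩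
  D + c          ≤⟨ fits ⟩
  2 * B′         ≤⟨ *-monoʳ-≤ 2 B′≤B+s ⟩
  2 * (B + s)    ≡⟨ *-distribˡ-+ 2 B s ⟩
  2 * B + 2 * s  ∎)
  where open ≤-Reasoning

evenBudget-step : ∀ h → evenBudget (suc h) ≤ evenBudget h + 2
evenBudget-step zero    = z≤n
evenBudget-step (suc h) = ≤-reflexive (solve 1 (λ h → (con 1 :+ h) :+ (con 1 :+ h) := (h :+ h) :+ con 2) refl h)

oddBudget-step : ∀ j → oddBudget (5 + j) ≡ oddBudget (4 + j) + 4
oddBudget-step j = solve 1 (λ j → con 14 :+ con 4 :* (con 1 :+ j) := (con 14 :+ con 4 :* j) :+ con 4) refl j

oddBudget-bound : ∀ m → oddBudget (suc m) ≤ (suc m + suc m) + (m + m)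
oddBudget-bound 0 = ≤-refl
oddBudget-bound 1 = s≤s (s≤s (s≤s (s≤s (s≤s z≤n))))
oddBudget-bound 2 = s≤s (s≤s (s≤s (s≤s (s≤s (s≤s (s≤s (s≤s (s≤s z≤n))))))))
oddBudget-bound 3 = ≤-refl
oddBudget-bound (suc (suc (suc (suc j)))) =
  ≤-reflexive (solve 1 (λ j → con 14 :+ con 4 :* (con 1 :+ j)
                            := ((con 5 :+ j) :+ (con 5 :+ j)) :+ ((con 4 :+ j) :+ (con 4 :+ j))) refl j)

-- Even step, p isolated: its non-degree 2h+1 alone exceeds the budget.
even-isolated : ∀ h k D → k + 1 ≡ suc h + suc h → 2 * k ≤ D → D ≤ 2 * evenBudget (suc h) → ⊥
even-isolated h k D |W| 2k≤D D≤budget = <⇒≱ (≤-trans 2E<2k 2k≤D) D≤budget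
  where
  k≡ : k ≡ h + suc h
  k≡ = suc-injective (trans (+-comm 1 k) |W|)
  2E<2k : 2 * (h + h) < 2 * k
  2E<2k = subst (λ z → 2 * (h + h) < 2 * z) (sym k≡) (*-monoʳ-< 2 (+-monoʳ-< h (n<1+n h)))

-- Even step, pair pq: the budget grows by only 2, so k + e ≤ 1, and then
-- the greedy bound leaves no room for the remaining defect D.
even-pair : ∀ h k e d D → D + 2 * e + 2 * k ≤ 2 * evenBudget (suc h) → 2 * evenBudget h < D →
            e ≤ k → D + 2 * e + 2 * k ≤ k + (k * k + d * e) → ⊥
even-pair h k e d D fits D-large e≤k greedy = <⇒≱ (≤-trans (s≤s z≤n) D-large) (D≤0 k e e≤k cost<4 greedy)
  where
  cost<4 : 2 * e + 2 * k < 4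
  cost<4 = increment-bound (evenBudget h) (evenBudget (suc h)) 2 D (2 * e + 2 * k) D-large
             (≤-trans (≤-reflexive (sym (+-assoc D (2 * e) (2 * k)))) fits) (evenBudget-step h)
  D≤0 : ∀ k e → e ≤ k → 2 * e + 2 * k < 4 → D + 2 * e + 2 * k ≤ k + (k * k + d * e) → D ≤ 0
  D≤0 0 0 _ _ greedy rewrite *-zeroʳ d | +-identityʳ D | +-identityʳ D = greedy
  D≤0 1 0 _ _ greedy rewrite *-zeroʳ d | +-identityʳ D = +-cancelʳ-≤ 2 D 0 greedy
  D≤0 1 1 _ (s≤s (s≤s (s≤s (s≤s ())))) _
  D≤0 0 (suc e) () _ _
  D≤0 1 (suc (suc e)) (s≤s ()) _ _
  D≤0 (suc (suc k)) e _ cost _ =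
    ⊥-elim (<⇒≱ cost (≤-trans (*-monoʳ-≤ 2 (s≤s (s≤s (z≤n {k})))) (m≤n+m (2 * suc (suc k)) (2 * e))))

-- Odd step, p isolated: removing p alone leaves a set within the even budget.
odd-isolated : ∀ m k D → k + 1 ≡ suc (m + m) → D + 2 * k ≤ 2 * oddBudget m → D ≤ 2 * evenBudget m
odd-isolated zero    k D |W| fits = m+n≤o⇒m≤o D fits
odd-isolated (suc m) k D |W| fits = +-cancelʳ-≤ (2 * k) D (2 * (m + m)) (begin
  D + 2 * k                    ≤⟨ fits ⟩
  2 * oddBudget (suc m)        ≤⟨ *-monoʳ-≤ 2 (oddBudget-bound m) ⟩
  2 * (k′ + (m + m))           ≡⟨ *-distribˡ-+ 2 k′ (m + m) ⟩
  2 * k′ + 2 * (m + m)         ≡⟨ +-comm (2 * k′) _ ⟩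
  2 * (m + m) + 2 * k′         ≡⟨ cong (λ z → 2 * (m + m) + 2 * z) (sym k≡) ⟩
  2 * (m + m) + 2 * k          ∎)
  where
  open ≤-Reasoning
  k′ : ℕ
  k′ = suc m + suc m
  k≡ : k ≡ k′
  k≡ = suc-injective (trans (+-comm 1 k) |W|)

greedy-slack : ∀ k e d → k ≤ 3 → e ≤ 1 → k + (k * k + d * e) ≤ 2 * e + 2 * k + (6 + d)
greedy-slack k e d k≤3 e≤1 = begin
  k + (k * k + d * e)      ≤⟨ +-monoʳ-≤ k (+-monoʳ-≤ (k * k) (≤-trans (*-monoʳ-≤ d e≤1) (≤-reflexive (*-identityʳ d)))) ⟩
  k + (k * k + d)          ≡⟨ sym (+-assoc k (k * k) d) ⟩
  k + k * k + d            ≤⟨ +-monoˡ-≤ d (square-slack k k≤3) ⟩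
  2 * k + 6 + d            ≡⟨ +-assoc (2 * k) 6 d ⟩
  2 * k + (6 + d)          ≤⟨ m≤n+m (2 * k + (6 + d)) (2 * e) ⟩
  2 * e + (2 * k + (6 + d)) ≡⟨ sym (+-assoc (2 * e) (2 * k) (6 + d)) ⟩
  2 * e + 2 * k + (6 + d)  ∎
  where
  open ≤-Reasoning
  square-slack : ∀ k → k ≤ 3 → k + k * k ≤ 2 * k + 6
  square-slack 0 _ = z≤n
  square-slack 1 _ = ≤ᵇ⇒≤ 2 8 _
  square-slack 2 _ = ≤ᵇ⇒≤ 6 10 _
  square-slack 3 _ = ≤-refl
  square-slack (suc (suc (suc (suc k)))) (s≤s (s≤s (s≤s ())))

-- Odd pair step for m ≥ 4: the budget grows by 4, so e + k ≤ 3, and the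
-- greedy bound then caps the remaining defect D at 6 + d ≤ 2m + 8, far
-- below 2·oddBudget m.
odd-pair-large : ∀ j k e d D → d + k + 1 ≡ suc (suc (4 + j) + suc (4 + j)) →
                 D + 2 * e + 2 * k ≤ 2 * oddBudget (5 + j) → 2 * oddBudget (4 + j) < D →
                 e ≤ k → D + 2 * e + 2 * k ≤ k + (k * k + d * e) → ⊥
odd-pair-large j k e d D |W| fits D-large e≤k greedy = <⇒≱ (<-trans small<budget D-large) D≤6+d
  where
  cost<8 : 2 * e + 2 * k < 2 * 4
  cost<8 = increment-bound (oddBudget (4 + j)) (oddBudget (5 + j)) 4 D (2 * e + 2 * k) D-large
             (≤-trans (≤-reflexive (sym (+-assoc D (2 * e) (2 * k)))) fits) (≤-reflexive (oddBudget-step j))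
  e+k<4 : e + k < 4
  e+k<4 = *-cancelˡ-< 2 (e + k) 4 (subst (_< 2 * 4) (sym (*-distribˡ-+ 2 e k)) cost<8)
  k≤3 : k ≤ 3
  k≤3 = ≤-pred (≤-trans (s≤s (m≤n+m k e)) e+k<4)
  e≤1 : e ≤ 1
  e≤1 = ≤-pred (*-cancelˡ-< 2 e 2 (≤-<-trans (+-monoʳ-≤ e (≤-trans (≤-reflexive (+-identityʳ e)) e≤k)) e+k<4))
  D≤6+d : D ≤ 6 + d
  D≤6+d = +-cancelˡ-≤ (2 * e + 2 * k) D (6 + d) (begin
    2 * e + 2 * k + D     ≡⟨ +-comm (2 * e + 2 * k) D ⟩
    D + (2 * e + 2 * k)   ≡⟨ sym (+-assoc D (2 * e) (2 * k)) ⟩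
    D + 2 * e + 2 * k     ≤⟨ greedy ⟩
    k + (k * k + d * e)   ≤⟨ greedy-slack k e d k≤3 e≤1 ⟩
    2 * e + 2 * k + (6 + d) ∎)
    where open ≤-Reasoning
  d≤ : d ≤ suc (4 + j) + suc (4 + j)
  d≤ = ≤-trans (m≤m+n d k) (≤-reflexive (suc-injective (trans (+-comm 1 (d + k)) |W|)))
  small<budget : 6 + d < 2 * oddBudget (4 + j)
  small<budget = ≤-trans (s≤s (+-monoʳ-≤ 6 d≤)) (≤-trans (m≤m+n (7 + (5 + j + (5 + j))) (11 + 6 * j))
    (≤-reflexive (solve 1 (λ j → (con 7 :+ ((con 5 :+ j) :+ (con 5 :+ j))) :+ (con 11 :+ con 6 :* j)
                                 := con 2 :* (con 14 :+ con 4 :* j)) refl j)))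

-- For m ≤ 3 the odd pair step is a finite check.  The least value the
-- remaining defect can take is 2·oddBudget m + 1; `OddPairFits m k e`
-- collects the constraints of the step at that value.
leastCost : ℕ → ℕ → ℕ → ℕ
leastCost m k e = 2 * oddBudget m + 1 + 2 * e + 2 * k

OddPairFits : ℕ → ℕ → ℕ → Set
OddPairFits m k e = leastCost m k e ≤ 2 * oddBudget (suc m)
                  × leastCost m k e ≤ k + (k * k + ((suc m + suc m) ∸ k) * e)
                  × e ≤ k

oddPairFits? : ∀ m k e → Dec (OddPairFits m k e)
oddPairFits? m k e = (leastCost m k e ≤? _) ×-dec (leastCost m k e ≤? _) ×-dec (e ≤? k)

no-small-odd-pair : ∀ (m : Fin 4) (k e : Fin 9) → ¬ OddPairFits (toℕ m) (toℕ k) (toℕ e)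
no-small-odd-pair = toWitness {a? = all? λ m → all? λ k → all? λ e → ¬? (oddPairFits? (toℕ m) (toℕ k) (toℕ e))} _

odd-pair-small : ∀ m k e d D → m ≤ 3 → d + k + 1 ≡ suc (suc m + suc m) →
                 D + 2 * e + 2 * k ≤ 2 * oddBudget (suc m) → 2 * oddBudget m < D →
                 e ≤ k → D + 2 * e + 2 * k ≤ k + (k * k + d * e) → ⊥
odd-pair-small m k e d D m≤3 |W| fits D-large e≤k greedy =
  no-small-odd-pair m′ k′ e′ (subst (λ x → OddPairFits x (toℕ k′) (toℕ e′)) (sym (toℕ-fromℕ< m<4))
                               (subst₂ (OddPairFits m) (sym (toℕ-fromℕ< k<9)) (sym (toℕ-fromℕ< e<9)) fits-least))
  where
  d+k : d + k ≡ suc m + suc m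
  d+k = suc-injective (trans (+-comm 1 (d + k)) |W|)
  m<4 : m < 4
  m<4 = s≤s m≤3
  k<9 : k < 9
  k<9 = s≤s (≤-trans (m≤n+m k d) (≤-trans (≤-reflexive d+k) (+-mono-≤ m<4 m<4)))
  e<9 : e < 9
  e<9 = ≤-trans (s≤s e≤k) k<9
  m′ : Fin 4
  m′ = fromℕ< m<4
  k′ e′ : Fin 9
  k′ = fromℕ< k<9
  e′ = fromℕ< e<9
  least≤ : leastCost m k e ≤ D + 2 * e + 2 * k
  least≤ = +-monoˡ-≤ (2 * k) (+-monoˡ-≤ (2 * e) (subst (_≤ D) (+-comm 1 _) D-large))
  d≡ : (suc m + suc m) ∸ k ≡ d
  d≡ = trans (cong (_∸ k) (sym d+k)) (m+n∸n≡m d k)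
  fits-least : OddPairFits m k e
  fits-least = ≤-trans least≤ fits
             , ≤-trans least≤ (subst (λ x → D + 2 * e + 2 * k ≤ k + (k * k + x * e)) (sym d≡) greedy)
             , e≤k

odd-pair : ∀ m k e d D → d + k + 1 ≡ suc (suc m + suc m) →
           D + 2 * e + 2 * k ≤ 2 * oddBudget (suc m) → 2 * oddBudget m < D →
           e ≤ k → D + 2 * e + 2 * k ≤ k + (k * k + d * e) → ⊥
odd-pair 0                             k e d D = odd-pair-small 0 k e d D z≤n
odd-pair 1                             k e d D = odd-pair-small 1 k e d D (s≤s z≤n)
odd-pair 2                             k e d D = odd-pair-small 2 k e d D (s≤s (s≤s z≤n))
odd-pair 3                             k e d D = odd-pair-small 3 k e d D (s≤s (s≤s (s≤s z≤n)))
odd-pair (suc (suc (suc (suc j)))) k e d D = odd-pair-large j k e d D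

module Greedy {n : ℕ} (H : Graph n) where
  open NonDegree H
  open MatchingOn H

  record MaxVertex (W : Subset n) : Set where
    field
      p     : Fin n
      p∈W   : W p ≡ true
      p-max : ∀ y → W y ≡ true → nonDeg W y ≤ nonDeg W p

  max-vertex : ∀ W → 0 < count W → MaxVertex W
  max-vertex W |W|>0 with argmax W (nonDeg W) (count-pos⇒witness W |W|>0)
  ... | p , p∈W , p-max = record { p = p ; p∈W = p∈W ; p-max = p-max }

  -- One greedy step: a vertex p of maximum non-degree k in W is matched
  -- with a neighbour q of maximum non-degree e, leaving (W ─ p) ─ q with
  -- defect D″ = defect W − 2e − 2k.  Since every vertex has non-degree at
  -- most k, and p's neighbours at most e, defect W ≤ k + k² + deg·e.
  record PairStep (W : Subset n) (p : Fin n) : Set where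
    field
      q      : Fin n
      q∈W    : W q ≡ true
      p≢q    : p ≢ q
      adj-pq : adj H p q ≡ true
      e≤k    : nonDeg W q ≤ nonDeg W p
      split  : defect W ≡ defect ((W ─ p) ─ q) + 2 * nonDeg W q + 2 * nonDeg W p
      greedy : defect W ≤ nonDeg W p + (nonDeg W p * nonDeg W p + deg W p * nonDeg W q)
      size   : count W ≡ suc (suc (count ((W ─ p) ─ q)))

    via-split : ∀ {X} → defect W ≤ X → defect ((W ─ p) ─ q) + 2 * nonDeg W q + 2 * nonDeg W p ≤ X
    via-split = subst (_≤ _) split

  pair-step : ∀ W (m : MaxVertex W) → 0 < deg W (MaxVertex.p m) → PairStep W (MaxVertex.p m)
  pair-step W m deg>0 = from-neighbour (argmax (Nbr W p) (nonDeg W) (count-pos⇒witness (Nbr W p) deg>0))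
    where
    open MaxVertex m
    from-neighbour : (∃ λ q → Nbr W p q ≡ true × (∀ y → Nbr W p y ≡ true → nonDeg W y ≤ nonDeg W q)) →
                     PairStep W p
    from-neighbour (q , q-nbr , q-max) = record
      { q = q ; q∈W = q∈W ; p≢q = λ p≡q → q≢p (sym p≡q) ; adj-pq = adj-pq ; e≤k = p-max q q∈W
      ; split  = trans (defect-remove W p p∈W)
                       (cong (_+ 2 * nonDeg W p) (trans (defect-remove (W ─ p) q q∈W─p)
                         (cong (λ e → defect ((W ─ p) ─ q) + 2 * e) (nonDeg-remove-nbr W p q adj-pq))))
      ; greedy = defect-bound W p (nonDeg W q) p∈W p-max q-max
      ; size   = trans (size-remove W p p∈W) (cong suc (size-remove (W ─ p) q q∈W─p)) }
      where
      q∈W : W q ≡ true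
      q∈W = proj₁ (Nbr-sound W p q q-nbr)
      q≢p : q ≢ p
      q≢p = proj₁ (proj₂ (Nbr-sound W p q q-nbr))
      adj-pq : adj H p q ≡ true
      adj-pq = proj₂ (proj₂ (Nbr-sound W p q q-nbr))
      q∈W─p : (W ─ p) q ≡ true
      q∈W─p = ─-inside W p q q∈W q≢p

  perfect-matching : ∀ h W → count W ≡ h + h → defect W ≤ 2 * evenBudget h → PerfectOn W
  perfect-matching zero    W |W| fits = perfectOn-empty W |W|
  perfect-matching (suc h) W |W| fits = from-max (max-vertex W (subst (0 <_) (sym |W|) (s≤s z≤n)))
    where
    from-max : MaxVertex W → PerfectOn W
    from-max mv = by-degree (deg W p) refl
      where
      open MaxVertex mv
      -- An isolated p would have non-degree 2h + 1, too many for the budget.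
      by-degree : ∀ d → deg W p ≡ d → PerfectOn W
      by-degree zero    deg≡0 = ⊥-elim (even-isolated h (nonDeg W p) (defect W) size-p (defect≥ W p p∈W) fits)
        where
        size-p : nonDeg W p + 1 ≡ suc h + suc h
        size-p = trans (cong (λ d → d + nonDeg W p + 1) (sym deg≡0)) (trans (deg+nonDeg W p p∈W) |W|)
      by-degree (suc _) deg≡ = from-pair (pair-step W mv (subst (0 <_) (sym deg≡) (s≤s z≤n)))
        where
        -- Either the rest fits the smaller budget, or the step's arithmetic fails.
        from-pair : PairStep W p → PerfectOn W
        from-pair step = decide (defect ((W ─ p) ─ q) ≤? 2 * evenBudget h)
          where
          open PairStep step
          rest-size : count ((W ─ p) ─ q) ≡ h + h
          rest-size = suc-injective (suc-injective (trans (sym size) (trans |W| (cong suc (+-suc h h)))))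
          decide : Dec (defect ((W ─ p) ─ q) ≤ 2 * evenBudget h) → PerfectOn W
          decide (yes rest-fits) =
            extend-perfect W p q p∈W q∈W p≢q adj-pq (perfect-matching h ((W ─ p) ─ q) rest-size rest-fits)
          decide (no rest-over) =
            ⊥-elim (even-pair h (nonDeg W p) (nonDeg W q) (deg W p) (defect ((W ─ p) ─ q))
                      (via-split fits) (≰⇒> rest-over) e≤k (via-split greedy))

  almost-perfect-matching : ∀ m W → count W ≡ suc (m + m) → defect W ≤ 2 * oddBudget m → AlmostPerfectOn W
  almost-perfect-matching m W |W| fits = from-max (max-vertex W (subst (0 <_) (sym |W|) (s≤s z≤n)))
    where
    from-max : MaxVertex W → AlmostPerfectOn W
    from-max mv = by-degree m (deg W p) refl |W| fits
      where
      open MaxVertex mv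
      by-degree : ∀ m d → deg W p ≡ d → count W ≡ suc (m + m) → defect W ≤ 2 * oddBudget m → AlmostPerfectOn W
      -- If p is isolated in W, the rest W ─ p fits the even budget.
      by-degree m zero deg≡0 |W| fits =
        leave-out W p p∈W (perfect-matching m (W ─ p) rest-size
          (odd-isolated m (nonDeg W p) (defect (W ─ p)) size-p (subst (_≤ 2 * oddBudget m) (defect-remove W p p∈W) fits)))
        where
        rest-size : count (W ─ p) ≡ m + m
        rest-size = suc-injective (trans (sym (size-remove W p p∈W)) |W|)
        size-p : nonDeg W p + 1 ≡ suc (m + m)
        size-p = trans (cong (λ d → d + nonDeg W p + 1) (sym deg≡0)) (trans (deg+nonDeg W p p∈W) |W|)
      -- A single vertex has no neighbours.
      by-degree zero (suc d) deg≡ |W| fits = ⊥-elim (m+1+n≢0 (d + nonDeg W p) (suc-injective size-p))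
        where
        size-p : suc d + nonDeg W p + 1 ≡ 1
        size-p = trans (cong (λ d → d + nonDeg W p + 1) (sym deg≡)) (trans (deg+nonDeg W p p∈W) |W|)
      by-degree (suc m) (suc _) deg≡ |W| fits = from-pair (pair-step W mv (subst (0 <_) (sym deg≡) (s≤s z≤n)))
        where
        from-pair : PairStep W p → AlmostPerfectOn W
        from-pair step = decide (defect ((W ─ p) ─ q) ≤? 2 * oddBudget m)
          where
          open PairStep step
          rest-size : count ((W ─ p) ─ q) ≡ suc (m + m)
          rest-size = suc-injective (suc-injective (trans (sym size) (trans |W| (cong (λ z → suc (suc z)) (+-suc m m)))))
          decide : Dec (defect ((W ─ p) ─ q) ≤ 2 * oddBudget m) → AlmostPerfectOn W
          decide (yes rest-fits) =
            extend-almost W p q p∈W q∈W p≢q adj-pq (almost-perfect-matching m ((W ─ p) ─ q) rest-size rest-fits)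
          decide (no rest-over) =
            ⊥-elim (odd-pair m (nonDeg W p) (nonDeg W q) (deg W p) (defect ((W ─ p) ─ q))
                      (trans (deg+nonDeg W p p∈W) |W|) (via-split fits) (≰⇒> rest-over) e≤k (via-split greedy))

_<ᵇ_ : ∀ {n} → Fin n → Fin n → Bool
i <ᵇ j = does (i <ᶠ? j)

nonEdges : ∀ {n} → Graph n → ℕ
nonEdges {n} G = ∑[ i < n ] ∑[ j < n ] ⟦ i <ᵇ j ∧ not (adj G i j) ⟧

listSum-allFin : ∀ {n} (f : Fin n → ℕ) → listSum (map f (allFin n)) ≡ sum f
listSum-allFin {n} f = trans (cong listSum (map-tabulate (λ i → i) f)) (listSum-tabulate f)
  where
  listSum-tabulate : ∀ {n} (f : Fin n → ℕ) → listSum (tabulate f) ≡ sum f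
  listSum-tabulate {zero}  f = refl
  listSum-tabulate {suc n} f = cong (f zero +_) (listSum-tabulate (λ i → f (suc i)))

-- Edges and non-edges together are all pairs: any two graphs on the same
-- vertices have the same total.
edges+nonEdges : ∀ {n} (G H : Graph n) → numEdges G + nonEdges G ≡ numEdges H + nonEdges H
edges+nonEdges {n} G H = trans (pairs G) (sym (pairs H))
  where
  pairs : ∀ G → numEdges G + nonEdges G ≡ ∑[ i < n ] ∑[ j < n ] ⟦ i <ᵇ j ⟧
  pairs G = begin
    numEdges G + nonEdges G
      ≡⟨ cong (_+ nonEdges G) numEdges-as-sum ⟩
    ∑[ i < n ] ∑[ j < n ] edge i j + ∑[ i < n ] ∑[ j < n ] nonEdge i j
      ≡⟨ sym (∑-distrib-+ (λ i → ∑[ j < n ] edge i j) (λ i → ∑[ j < n ] nonEdge i j)) ⟩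
    ∑[ i < n ] (∑[ j < n ] edge i j + ∑[ j < n ] nonEdge i j)
      ≡⟨ sum-cong-≗ (λ i → trans (sym (∑-distrib-+ (edge i) (nonEdge i))) (sum-cong-≗ (split i))) ⟩
    ∑[ i < n ] ∑[ j < n ] ⟦ i <ᵇ j ⟧ ∎
    where
    open ≡-Reasoning
    edge nonEdge : Fin n → Fin n → ℕ
    edge    i j = ⟦ i <ᵇ j ∧ adj G i j ⟧
    nonEdge i j = ⟦ i <ᵇ j ∧ not (adj G i j) ⟧
    numEdges-as-sum : numEdges G ≡ ∑[ i < n ] ∑[ j < n ] edge i j
    numEdges-as-sum = trans (listSum-allFin (λ i → listSum (map (edge i) (allFin n))))
                            (sum-cong-≗ (λ i → listSum-allFin (edge i)))
    split : ∀ i j → edge i j + nonEdge i j ≡ ⟦ i <ᵇ j ⟧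
    split i j with i <ᵇ j | adj G i j
    ... | true  | true  = refl
    ... | true  | false = refl
    ... | false | _     = refl

sum-symmetric : ∀ {n} (f : Fin n → Fin n → ℕ) → (∀ i j → f i j ≡ f j i) → (∀ i → f i i ≡ 0) →
                ∑[ i < n ] ∑[ j < n ] f i j ≡ 2 * ∑[ i < n ] ∑[ j < n ] (if i <ᵇ j then f i j else 0)
sum-symmetric {n} f f-sym f-diag = begin
  ∑[ i < n ] ∑[ j < n ] f i j
    ≡⟨ sum-cong-≗ (λ i → trans (sum-cong-≗ (split i)) (∑-distrib-+ (upper i) (lower i))) ⟩
  ∑[ i < n ] (∑[ j < n ] upper i j + ∑[ j < n ] lower i j)
    ≡⟨ ∑-distrib-+ (λ i → ∑[ j < n ] upper i j) (λ i → ∑[ j < n ] lower i j) ⟩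
  U + ∑[ i < n ] ∑[ j < n ] lower i j
    ≡⟨ cong (U +_) (∑-comm lower) ⟩
  U + ∑[ j < n ] ∑[ i < n ] lower i j
    ≡⟨ cong (U +_) (sum-cong-≗ (λ j → sum-cong-≗ (λ i → cong (if j <ᵇ i then_else 0) (f-sym i j)))) ⟩
  U + U
    ≡⟨ cong (U +_) (sym (+-identityʳ U)) ⟩
  2 * U ∎
  where
  open ≡-Reasoning
  upper lower : Fin n → Fin n → ℕ
  upper i j = if i <ᵇ j then f i j else 0
  lower i j = if j <ᵇ i then f i j else 0
  U : ℕ
  U = ∑[ i < n ] ∑[ j < n ] upper i j
  split : ∀ i j → f i j ≡ upper i j + lower i j
  split i j with <ᶠ-cmp i j
  ... | tri< i<j _ j≮i rewrite dec-true (i <ᶠ? j) i<j | dec-false (j <ᶠ? i) j≮i = sym (+-identityʳ _)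
  ... | tri> i≮j _ j<i rewrite dec-false (i <ᶠ? j) i≮j | dec-true (j <ᶠ? i) j<i = refl
  ... | tri≈ i≮i refl _ rewrite dec-false (i <ᶠ? i) i≮i = f-diag i

-- Each non-edge is counted at both of its endpoints.
defect-full : ∀ {n} (G : Graph n) → NonDegree.defect G full ≡ 2 * nonEdges G
defect-full {n} G = trans (sum-symmetric f f-sym f-diag) (cong (2 *_) (sum-cong-≗ (λ i → sum-cong-≗ (upper i))))
  where
  f : Fin n → Fin n → ℕ
  f x y = ⟦ not (y ≡ᵇ x) ∧ not (adj G x y) ⟧
  f-sym : ∀ i j → f i j ≡ f j i
  f-sym i j rewrite ≡ᵇ-sym j i | Graph.sym G i j = refl
  f-diag : ∀ i → f i i ≡ 0
  f-diag i rewrite ≡ᵇ-refl i = refl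
  upper : ∀ i j → (if i <ᵇ j then f i j else 0) ≡ ⟦ i <ᵇ j ∧ not (adj G i j) ⟧
  upper i j with i <ᶠ? j
  ... | no  i≮j rewrite dec-false (i <ᶠ? j) i≮j = refl
  ... | yes i<j rewrite dec-true (i <ᶠ? j) i<j | ≡ᵇ-≢ (λ j≡i → <ᶠ-irrefl (sym j≡i) i<j) = refl

few-non-edges⇒almost-perfect : ∀ m (H : Graph (suc (m + m))) → nonEdges H ≤ oddBudget m → HasAPM H
few-non-edges⇒almost-perfect m H few = M , M⊆H , missed , uncovers , λ v v≢missed → covers v refl v≢missed
  where
  open MatchingOn.AlmostPerfectOn
    (Greedy.almost-perfect-matching H m full (count-full _) (≤-trans (≤-reflexive (defect-full H)) (*-monoʳ-≤ 2 few)))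

exchange-≡ : ∀ {a b c d} k → a + b ≡ c + d → a ≡ c + k → d ≡ b + k
exchange-≡ {a} {b} {c} {d} k total a≡ = +-cancelˡ-≡ c d (b + k) (begin
  c + d        ≡⟨ sym total ⟩
  a + b        ≡⟨ cong (_+ b) a≡ ⟩
  c + k + b    ≡⟨ +-assoc c k b ⟩
  c + (k + b)  ≡⟨ cong (c +_) (+-comm k b) ⟩
  c + (b + k)  ∎)
  where open ≡-Reasoning

exchange-< : ∀ {a b c d} k → a + b ≡ c + d → a < c + k → d < b + k
exchange-< {a} {b} {c} {d} k total a< = +-cancelˡ-< c d (b + k) (begin-strict
  c + d        ≡⟨ sym total ⟩
  a + b        <⟨ +-monoˡ-< b a< ⟩
  c + k + b    ≡⟨ +-assoc c k b ⟩
  c + (k + b)  ≡⟨ cong (c +_) (+-comm k b) ⟩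
  c + (b + k)  ∎)
  where open ≤-Reasoning

module _ {n : ℕ} (G H : Graph n) (k : ℕ) where

  private
    total : nonEdges H + numEdges H ≡ nonEdges G + numEdges G
    total = trans (+-comm (nonEdges H) _) (trans (sym (edges+nonEdges G H)) (+-comm (numEdges G) _))

  removed⇒added : numEdges G ≡ numEdges H + k → nonEdges H ≡ nonEdges G + k
  removed⇒added = exchange-≡ k (edges+nonEdges G H)

  added⇒removed : nonEdges H ≡ nonEdges G + k → numEdges G ≡ numEdges H + k
  added⇒removed = exchange-≡ k total

  fewer-removed⇒fewer-added : numEdges G < numEdges H + k → nonEdges H < nonEdges G + k
  fewer-removed⇒fewer-added = exchange-< k (edges+nonEdges G H)

  fewer-added⇒fewer-removed : nonEdges H < nonEdges G + k → numEdges G < numEdges H + k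
  fewer-added⇒fewer-removed = exchange-< k total

avoids : ∀ {n} → Fin n → Fin n → Fin n → Bool
avoids u v x = not (x ≡ᵇ u) ∧ not (x ≡ᵇ v)

isolate : ∀ {n} → Graph n → Fin n → Fin n → Graph n
isolate G u v = record
  { adj    = λ i j → (avoids u v i ∧ avoids u v j) ∧ adj G i j
  ; sym    = λ i j → cong₂ _∧_ (Bool.∧-comm (avoids u v i) _) (Graph.sym G i j)
  ; irrefl = λ i → trans (cong (_ ∧_) (Graph.irrefl G i)) (Bool.∧-zeroʳ _)
  }

-- Isolating two distinct vertices u and v destroys all perfect and
-- almost-perfect matchings, at the cost of the edges at u or v: the
-- isolated graph gains (n − 1) + (n − 2) − nonEdgesAt u v non-edges.
module Isolation {n : ℕ} (G : Graph n) (u v : Fin n) (u≢v : u ≢ v) where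

  I : Graph n
  I = isolate G u v

  I-at-u : ∀ y → adj I u y ≡ false
  I-at-u y rewrite ≡ᵇ-refl u = refl

  I-at-v : ∀ y → adj I v y ≡ false
  I-at-v y rewrite ≡ᵇ-refl v | ≡ᵇ-≢ (λ v≡u → u≢v (sym v≡u)) = refl

  I⊆G : I ⊆ᴳ G
  I⊆G i j Iij with avoids u v i ∧ avoids u v j
  ... | true = Iij

  -- A matching of I misses both u and v.
  no-perfect : ¬ HasPM I
  no-perfect (M , M⊆I , covers) with covers u
  ... | w , Muw , _ with trans (sym (M⊆I u w Muw)) (I-at-u w)
  ...   | ()

  no-almost-perfect : ¬ HasAPM I
  no-almost-perfect (M , M⊆I , x , _ , covers) with u ≟ x
  ... | no u≢x with covers u u≢x
  ...   | w , Muw , _ with trans (sym (M⊆I u w Muw)) (I-at-u w)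
  ...     | ()
  no-almost-perfect (M , M⊆I , x , _ , covers) | yes refl with covers v (λ v≡u → u≢v (sym v≡u))
  ...   | w , Mvw , _ with trans (sym (M⊆I v w Mvw)) (I-at-v w)
  ...     | ()

  v-after-u : (full ─ u) v ≡ true
  v-after-u = ─-inside full u v refl (λ v≡u → u≢v (sym v≡u))

  rest : Subset n
  rest = (full ─ u) ─ v

  defect-rest : NonDegree.defect G rest ≡ NonDegree.defect I rest
  defect-rest = sum-cong-≗ same-term
    where
    same-nonNbr : ∀ x → avoids u v x ≡ true → ∀ y →
                  ⟦ NonDegree.NonNbr G rest x y ⟧ ≡ ⟦ NonDegree.NonNbr I rest x y ⟧
    same-nonNbr x x-avoids y rewrite x-avoids with avoids u v y
    ... | true  = refl
    ... | false = refl
    same-term : ∀ x → (if rest x then NonDegree.nonDeg G rest x else 0)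
                    ≡ (if rest x then NonDegree.nonDeg I rest x else 0)
    same-term x = if-cong (rest x) (λ x∈rest → sum-cong-≗ (same-nonNbr x x∈rest))
      where
      if-cong : ∀ b {s t} → (b ≡ true → s ≡ t) → (if b then s else 0) ≡ (if b then t else 0)
      if-cong true  s≡t = s≡t refl
      if-cong false _   = refl

  nonDeg-I-u : NonDegree.nonDeg I full u ≡ count (full ─ u)
  nonDeg-I-u = sum-cong-≗ (λ y → cong ⟦_⟧ (trans (cong (λ b → not (y ≡ᵇ u) ∧ not b) (I-at-u y)) (Bool.∧-identityʳ _)))

  nonDeg-I-v : NonDegree.nonDeg I (full ─ u) v ≡ count rest
  nonDeg-I-v = sum-cong-≗ (λ y → cong ⟦_⟧ (cong (not (y ≡ᵇ u) ∧_)
                 (trans (cong (λ b → not (y ≡ᵇ v) ∧ not b) (I-at-v y)) (Bool.∧-identityʳ _))))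

  defect-around : ∀ (K : Graph n) → 2 * nonEdges K ≡
                  NonDegree.defect K rest + 2 * NonDegree.nonDeg K (full ─ u) v + 2 * NonDegree.nonDeg K full u
  defect-around K = trans (sym (defect-full K)) (trans (defect-remove full u refl)
                      (cong (_+ 2 * nonDeg full u) (defect-remove (full ─ u) v v-after-u)))
    where open NonDegree K

  isolation-count : nonEdges I + NonDegree.nonEdgesAt G u v ≡ nonEdges G + (count (full ─ u) + count rest)
  isolation-count = halve (nonEdges G) (nonEdges I) (NonDegree.defect G rest)
                      (NonDegree.nonDeg G (full ─ u) v) (NonDegree.nonDeg G full u) (count rest) (count (full ─ u))
                      (defect-around G) (trans (defect-around I)
                      (cong₃ (λ X s t → X + 2 * s + 2 * t) (sym defect-rest) nonDeg-I-v nonDeg-I-u))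
    where
    cong₃ : ∀ (f : ℕ → ℕ → ℕ → ℕ) {x x′ y y′ z z′} → x ≡ x′ → y ≡ y′ → z ≡ z′ → f x y z ≡ f x′ y′ z′
    cong₃ f refl refl refl = refl
    halve : ∀ a a′ X b c b′ c′ → 2 * a ≡ X + 2 * b + 2 * c → 2 * a′ ≡ X + 2 * b′ + 2 * c′ →
            a′ + (c + b) ≡ a + (c′ + b′)
    halve a a′ X b c b′ c′ eq eq′ = *-cancelˡ-≡ _ _ 2 (+-cancelʳ-≡ X _ _ (begin
      2 * (a′ + (c + b)) + X        ≡⟨ regroup a′ c b ⟩
      2 * a′ + (X + 2 * b + 2 * c)  ≡⟨ cong (2 * a′ +_) (sym eq) ⟩
      2 * a′ + 2 * a                ≡⟨ +-comm (2 * a′) (2 * a) ⟩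
      2 * a + 2 * a′                ≡⟨ cong (2 * a +_) eq′ ⟩
      2 * a + (X + 2 * b′ + 2 * c′) ≡⟨ sym (regroup a c′ b′) ⟩
      2 * (a + (c′ + b′)) + X       ∎))
      where
      open ≡-Reasoning
      regroup : ∀ a c b → 2 * (a + (c + b)) + X ≡ 2 * a + (X + 2 * b + 2 * c)
      regroup = solve 4 (λ X a c b → con 2 :* (a :+ (c :+ b)) :+ X := con 2 :* a :+ (X :+ con 2 :* b :+ con 2 :* c)) refl X

complete⇒nonEdges≡0 : ∀ {n} (G : Graph n) → (∀ a b → a ≢ b → adj G a b ≡ true) → nonEdges G ≡ 0
complete⇒nonEdges≡0 {n} G complete =
  trans (sum-cong-≗ (λ i → trans (sum-cong-≗ (no-non-edge i)) (sum-replicate-zero n))) (sum-replicate-zero n)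
  where
  no-non-edge : ∀ i j → ⟦ i <ᵇ j ∧ not (adj G i j) ⟧ ≡ 0
  no-non-edge i j with i <ᶠ? j
  ... | no  i≮j rewrite dec-false (i <ᶠ? j) i≮j = refl
  ... | yes i<j rewrite dec-true (i <ᶠ? j) i<j | complete i j (λ i≡j → <ᶠ-irrefl i≡j i<j) = refl

-- Two different non-edges ab and cd yield two vertices u, v meeting at
-- least two non-edges: a and b if the non-edges share a, else a and c.
two-non-edges : ∀ {n} (G : Graph n) {a b c d : Fin n} → a ≢ b → adj G a b ≡ false → c ≢ d → adj G c d ≡ false →
                ¬ ((c ≡ a × d ≡ b) ⊎ (c ≡ b × d ≡ a)) →
                ∃ λ u → ∃ λ v → u ≢ v × 2 ≤ NonDegree.nonEdgesAt G u v
two-non-edges {n} G {a} {b} {c} {d} a≢b ab-missing c≢d cd-missing not-ab = by-cases (c ≟ a) (d ≟ a)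
  where
  open NonDegree G
  one≤ : ∀ W x y → NonNbr W x y ≡ true → 1 ≤ ⟦ NonNbr W x y ⟧
  one≤ W x y nonNbr = ≤-reflexive (cong ⟦_⟧ (sym nonNbr))
  two-at-a : ∀ {y z} → y ≢ z → y ≢ a → z ≢ a → adj G a y ≡ false → adj G a z ≡ false →
             ∃ λ u → ∃ λ v → u ≢ v × 2 ≤ nonEdgesAt u v
  two-at-a {y} {z} y≢z y≢a z≢a ay az =
    a , b , a≢b , ≤-trans (sum≥2 (λ w → ⟦ NonNbr full a w ⟧) y≢z (one≤ full a y (NonNbr-intro full a y refl y≢a ay))
                                                                   (one≤ full a z (NonNbr-intro full a z refl z≢a az)))
                          (m≤m+n (nonDeg full a) _)
  by-cases : Dec (c ≡ a) → Dec (d ≡ a) → ∃ λ u → ∃ λ v → u ≢ v × 2 ≤ nonEdgesAt u v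
  by-cases (yes refl) _ = two-at-a (λ b≡d → not-ab (inj₁ (refl , sym b≡d))) (λ b≡c → a≢b (sym b≡c))
                                   (λ d≡c → c≢d (sym d≡c)) ab-missing cd-missing
  by-cases (no c≢a) (yes refl) = two-at-a (λ b≡c → not-ab (inj₂ (sym b≡c , refl))) (λ b≡d → a≢b (sym b≡d))
                                          c≢a ab-missing (trans (Graph.sym G d c) cd-missing)
  by-cases (no c≢a) (no d≢a) =
    a , c , (λ a≡c → c≢a (sym a≡c)) ,
    +-mono-≤ (nonNbr⇒nonDeg≥1 full a b (NonNbr-intro full a b refl (λ b≡a → a≢b (sym b≡a)) ab-missing))
             (nonNbr⇒nonDeg≥1 (full ─ a) c d (NonNbr-intro (full ─ a) c d (─-inside full a d refl d≢a)
                                                            (λ d≡c → c≢d (sym d≡c)) cd-missing))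

module MissingOneEdge {n : ℕ} (G : Graph n) (a b : Fin n) (a≢b : a ≢ b)
    (edges-avoid-ab : ∀ i j → adj G i j ≡ true → (i ≢ j × ¬ ((i ≡ a × j ≡ b) ⊎ (i ≡ b × j ≡ a))))
    (others-are-edges : ∀ i j → i ≢ j → ¬ ((i ≡ a × j ≡ b) ⊎ (i ≡ b × j ≡ a)) → adj G i j ≡ true) where
  open NonDegree G

  non-adjacent≡isPair : ∀ x y → (not (y ≡ᵇ x) ∧ not (adj G x y)) ≡ isPair a b x y
  non-adjacent≡isPair x y with adj G x y in x~y
  ... | true  = trans (Bool.∧-zeroʳ _)
                      (sym (Bool.¬-not (λ pair → proj₂ (edges-avoid-ab x y x~y) (isPair-sound a b x y pair))))
  ... | false = by-cases (y ≟ x)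
    where
    by-cases : Dec (y ≡ x) → (not (y ≡ᵇ x) ∧ true) ≡ isPair a b x y
    by-cases (yes refl) rewrite ≡ᵇ-refl y = sym (isPair-irrefl a≢b y)
    by-cases (no y≢x) rewrite ≡ᵇ-≢ y≢x = sym (Bool.¬-not not-pair)
      where
      not-pair : isPair a b x y ≢ false
      not-pair no-pair with trans (sym x~y) (others-are-edges x y (λ x≡y → y≢x (sym x≡y))
                                               (λ pair → Bool.not-¬ (isPair-complete a b x y pair) no-pair))
      ... | ()

  nonDeg-full : ∀ x → nonDeg full x ≡ ⟦ x ≡ᵇ a ⟧ + ⟦ x ≡ᵇ b ⟧
  nonDeg-full x = trans (sum-cong-≗ (λ y → cong ⟦_⟧ (non-adjacent≡isPair x y))) (count-isPair a≢b x)

  nonEdges≡1 : nonEdges G ≡ 1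
  nonEdges≡1 = *-cancelˡ-≡ _ _ 2 (begin
    2 * nonEdges G                     ≡⟨ sym (defect-full G) ⟩
    defect full                        ≡⟨ sum-cong-≗ nonDeg-full ⟩
    ∑[ x < n ] (⟦ x ≡ᵇ a ⟧ + ⟦ x ≡ᵇ b ⟧) ≡⟨ ∑-distrib-+ (λ x → ⟦ x ≡ᵇ a ⟧) (λ x → ⟦ x ≡ᵇ b ⟧) ⟩
    count (_≡ᵇ a) + count (_≡ᵇ b)      ≡⟨ cong₂ _+_ (count-point a) (count-point b) ⟩
    2                                  ∎)
    where open ≡-Reasoning

  -- a meets the single non-edge, and b meets no further one.
  nonEdgesAt-ab : nonEdgesAt a b ≡ 1
  nonEdgesAt-ab = cong₂ _+_ nonDeg-a nonDeg-b
    where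
    nonDeg-a : nonDeg full a ≡ 1
    nonDeg-a rewrite nonDeg-full a | ≡ᵇ-refl a | ≡ᵇ-≢ a≢b = refl
    a-nonNbr-of-b : NonNbr full b a ≡ true
    a-nonNbr-of-b = trans (non-adjacent≡isPair b a) (isPair-complete a b b a (inj₂ (refl , refl)))
    nonDeg-b : nonDeg (full ─ a) b ≡ 0
    nonDeg-b = +-cancelʳ-≡ 1 _ 0 (begin
      nonDeg (full ─ a) b + 1                        ≡⟨ cong (nonDeg (full ─ a) b +_) (cong ⟦_⟧ (sym a-nonNbr-of-b)) ⟩
      nonDeg (full ─ a) b + ⟦ NonNbr full b a ⟧      ≡⟨ sym (nonDeg-remove full a b) ⟩
      nonDeg full b                                  ≡⟨ nonDeg-full b ⟩
      ⟦ b ≡ᵇ a ⟧ + ⟦ b ≡ᵇ b ⟧                          ≡⟨ cong₂ (λ s t → ⟦ s ⟧ + ⟦ t ⟧) (≡ᵇ-≢ (λ b≡a → a≢b (sym b≡a))) (≡ᵇ-refl b) ⟩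
      1                                              ∎)
      where open ≡-Reasoning

-- Deleting fewer than k edges of G always leaves a perfect or an
-- almost-perfect matching: the minimality half of IsMP G k.
Robust : ∀ {n} → Graph n → ℕ → Set
Robust G k = ∀ H → H ⊆ᴳ G → numEdges G < numEdges H + k → HasPM H ⊎ HasAPM H

-- Graphs of odd order N = 2m + 1 ≥ 9, written with m = 4 + j.
module OddOrder (j : ℕ) where

  m N : ℕ
  m = 4 + j
  N = suc (m + m)

  budget : 2 * N ∸ 4 ≡ oddBudget m
  budget = cong (_∸ 4) (solve 1 (λ j → con 2 :* (con 1 :+ ((con 4 :+ j) :+ (con 4 :+ j))) := con 18 :+ con 4 :* j) refl j)

  isolation-added : (G : Graph N) (u v : Fin N) (u≢v : u ≢ v) →
                    nonEdges (isolate G u v) + NonDegree.nonEdgesAt G u v ≡ nonEdges G + suc (2 * N ∸ 4)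
  isolation-added G u v u≢v = trans (Isolation.isolation-count G u v u≢v) (cong (nonEdges G +_) sizes)
    where
    others-than-u : count (full ─ u) ≡ m + m
    others-than-u = suc-injective (trans (sym (size-remove full u refl)) (count-full N))
    others-than-uv : count ((full ─ u) ─ v) ≡ (3 + j) + (4 + j)
    others-than-uv = suc-injective (trans (sym (size-remove (full ─ u) v (Isolation.v-after-u G u v u≢v))) others-than-u)
    sizes : count (full ─ u) + count ((full ─ u) ─ v) ≡ suc (2 * N ∸ 4)
    sizes = trans (cong₂ _+_ others-than-u others-than-uv)
                  (trans (solve 1 (λ j → ((con 4 :+ j) :+ (con 4 :+ j)) :+ ((con 3 :+ j) :+ (con 4 :+ j))
                                         := con 15 :+ con 4 :* j) refl j)
                         (cong suc (sym budget)))

  -- K_N − ab has matching preclusion number 2N − 4: isolating a and b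
  -- deletes exactly 2N − 4 edges, and after deleting fewer the at most
  -- 2N − 4 non-edges leave an almost-perfect matching.
  Kn-e⇒mp : (G : Graph N) → IsKnMinusEdge G → IsMP G (2 * N ∸ 4)
  Kn-e⇒mp G (a , b , a≢b , edges-avoid-ab , others-are-edges) =
    (I , I⊆G , removed , no-perfect , no-almost-perfect) , robust
    where
    open Isolation G a b a≢b
    open MissingOneEdge G a b a≢b edges-avoid-ab others-are-edges
    removed : numEdges G ≡ numEdges I + (2 * N ∸ 4)
    removed = added⇒removed G I (2 * N ∸ 4) (+-cancelʳ-≡ 1 _ _ (begin
      nonEdges I + 1                              ≡⟨ cong (nonEdges I +_) (sym nonEdgesAt-ab) ⟩
      nonEdges I + NonDegree.nonEdgesAt G a b     ≡⟨ isolation-added G a b a≢b ⟩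
      nonEdges G + suc (2 * N ∸ 4)                ≡⟨ +-suc (nonEdges G) _ ⟩
      suc (nonEdges G + (2 * N ∸ 4))              ≡⟨ +-comm 1 _ ⟩
      nonEdges G + (2 * N ∸ 4) + 1                ∎))
      where open ≡-Reasoning
    robust : Robust G (2 * N ∸ 4)
    robust H H⊆G fewer = inj₂ (few-non-edges⇒almost-perfect m H (subst (nonEdges H ≤_) budget (≤-pred H-few)))
      where
      H-few : nonEdges H < suc (2 * N ∸ 4)
      H-few = subst (λ e → nonEdges H < e + (2 * N ∸ 4)) nonEdges≡1 (fewer-removed⇒fewer-added G H _ fewer)

  -- If mp(G) = 2N − 4, no two vertices meet two non-edges: isolating them
  -- would preclude all matchings with fewer than 2N − 4 deletions.
  no-heavy-pair : (G : Graph N) → Robust G (2 * N ∸ 4) → ∀ u v → u ≢ v → 2 ≤ NonDegree.nonEdgesAt G u v → ⊥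
  no-heavy-pair G robust u v u≢v heavy = [ no-perfect , no-almost-perfect ] (robust I I⊆G cheaper)
    where
    open Isolation G u v u≢v
    I-fewer : nonEdges I < nonEdges G + (2 * N ∸ 4)
    I-fewer = ≤-pred (begin
      suc (suc (nonEdges I))                  ≡⟨ +-comm 2 (nonEdges I) ⟩
      nonEdges I + 2                          ≤⟨ +-monoʳ-≤ (nonEdges I) heavy ⟩
      nonEdges I + NonDegree.nonEdgesAt G u v ≡⟨ isolation-added G u v u≢v ⟩
      nonEdges G + suc (2 * N ∸ 4)            ≡⟨ +-suc (nonEdges G) _ ⟩
      suc (nonEdges G + (2 * N ∸ 4))          ∎)
      where open ≤-Reasoning
    cheaper : numEdges G < numEdges I + (2 * N ∸ 4)
    cheaper = fewer-added⇒fewer-removed G I _ I-fewer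

  -- Conversely, mp(G) = 2N − 4 forces G = K_N − ab: G has a non-edge ab
  -- (a complete G keeps an almost-perfect matching after 2N − 4 deletions),
  -- and any further non-edge would give two vertices meeting two non-edges.
  mp⇒Kn-e : (G : Graph N) → IsMP G (2 * N ∸ 4) → IsKnMinusEdge G
  mp⇒Kn-e G ((H , H⊆G , removed , _ , no-almost-perfect) , robust) = from-non-edge has-non-edge
    where
    has-non-edge : ∃ λ a → ∃ λ b → a ≢ b × adj G a b ≡ false
    has-non-edge with any? (λ a → any? (λ b → ¬? (a ≟ b) ×-dec (adj G a b Bool.≟ false)))
    ... | yes non-edge = non-edge
    ... | no complete  = ⊥-elim (no-almost-perfect (few-non-edges⇒almost-perfect m H (≤-reflexive H-count)))
      where
      all-edges : ∀ a b → a ≢ b → adj G a b ≡ true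
      all-edges a b a≢b = Bool.¬-not (λ ab → complete (a , b , a≢b , ab))
      H-count : nonEdges H ≡ oddBudget m
      H-count = trans (removed⇒added G H _ removed) (cong₂ _+_ (complete⇒nonEdges≡0 G all-edges) budget)
    from-non-edge : (∃ λ a → ∃ λ b → a ≢ b × adj G a b ≡ false) → IsKnMinusEdge G
    from-non-edge (a , b , a≢b , ab-missing) = a , b , a≢b , edges-avoid-ab , others-are-edges
      where
      true≢false : true ≢ false
      true≢false ()
      edges-avoid-ab : ∀ i j → adj G i j ≡ true → (i ≢ j × ¬ ((i ≡ a × j ≡ b) ⊎ (i ≡ b × j ≡ a)))
      edges-avoid-ab i j ij =
        (λ { refl → true≢false (trans (sym ij) (Graph.irrefl G i)) }) ,
        (λ { (inj₁ (refl , refl)) → true≢false (trans (sym ij) ab-missing)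
           ; (inj₂ (refl , refl)) → true≢false (trans (sym ij) (trans (Graph.sym G b a) ab-missing)) })
      others-are-edges : ∀ i j → i ≢ j → ¬ ((i ≡ a × j ≡ b) ⊎ (i ≡ b × j ≡ a)) → adj G i j ≡ true
      others-are-edges i j i≢j not-ab = Bool.¬-not second-non-edge
        where
        second-non-edge : adj G i j ≢ false
        second-non-edge ij-missing with two-non-edges G a≢b ab-missing i≢j ij-missing not-ab
        ... | u , v , u≢v , heavy = no-heavy-pair G robust u v u≢v heavy

odd≥9-form : ∀ n → n % 2 ≡ 1 → 9 ≤ n → ∃ λ j → n ≡ suc ((4 + j) + (4 + j))
odd≥9-form n odd 9≤n = h ∸ 4 , trans n≡ (cong suc (trans (cong (_* 2) (sym (m+[n∸m]≡n 4≤h)))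
                          (solve 1 (λ j → (con 4 :+ j) :* con 2 := (con 4 :+ j) :+ (con 4 :+ j)) refl (h ∸ 4))))
  where
  h : ℕ
  h = n / 2
  n≡ : n ≡ suc (h * 2)
  n≡ = trans (m≡m%n+[m/n]*n n 2) (cong (_+ h * 2) odd)
  4≤h : 4 ≤ h
  4≤h = *-cancelʳ-≤ 4 h 2 (≤-pred (subst (9 ≤_) n≡ 9≤n))

theorem3p8 : (n : ℕ) → n % 2 ≡ 1 → 9 ≤ n → (G : Graph n) →
    IsMP G (2 * n ∸ 4) ⇔ IsKnMinusEdge G
theorem3p8 n odd 9≤n G with odd≥9-form n odd 9≤n
... | j , refl = mk⇔ (OddOrder.mp⇒Kn-e j G) (OddOrder.Kn-e⇒mp j G)
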